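{- If $p$ is an integer with $p\ge 3$, then $\mathrm{ex}(p+4,B_p)=(p+2)(p+3)/2$.
   Context: The book $B_p$ is the graph consisting of $p$ triangles sharing a common edge. For a graph $H$ and positive integer $n$, $\mathrm{ex}(n,H)$ is the maximum number of edges of a simple graph of order $n$ not containing $H$ as a subgraph. -}

module Defs where

open import Data.Nat using (ℕ; zero; suc; _+_; _<ᵇ_; _≤_)
open import Data.Fin using (Fin; toℕ)
open import Data.Bool using (Bool; true; false; _∧_; if_then_else_)
open import Data.List using (List; map; allFin)
open import Data.Nat.ListAction using (sum)
open import Data.Product using (Σ; _×_)
open import Relation.Binary.PropositionalEquality using (_≡_; refl)
open import Relation.Nullary using (¬_)
open import Function.Definitions using (Injective)

record SimpleGraph (n : ℕ) : Set where
  field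
    Adj    : Fin n → Fin n → Bool
    sym    : ∀ i j → Adj i j ≡ Adj j i
    irrefl : ∀ i → Adj i i ≡ false
open SimpleGraph public

edgeCount : {n : ℕ} → SimpleGraph n → ℕ
edgeCount {n} G =
  sum (map (λ i → sum (map (λ j → if (toℕ i <ᵇ toℕ j) ∧ Adj G i j then 1 else 0)
                           (allFin n)))
           (allFin n))

_⊆G_ : {m n : ℕ} → SimpleGraph m → SimpleGraph n → Set
_⊆G_ {m} {n} H G =
  Σ (Fin m → Fin n) λ f →
    Injective _≡_ _≡_ f × (∀ i j → Adj H i j ≡ true → Adj G (f i) (f j) ≡ true)

-- Adjacency of the book on ℕ-labels: labels 0 and 1 form the spine (an edge),
-- every other label k ≥ 2 is adjacent exactly to 0 and 1.
bookSpine : ℕ → ℕ → Bool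
bookSpine 0 0 = false
bookSpine 0 _ = true
bookSpine 1 1 = false
bookSpine 1 _ = true
bookSpine (suc (suc a)) 0 = true
bookSpine (suc (suc a)) 1 = true
bookSpine (suc (suc a)) (suc (suc b)) = false

bookSpine-sym : ∀ a b → bookSpine a b ≡ bookSpine b a
bookSpine-sym 0 0 = refl
bookSpine-sym 0 1 = refl
bookSpine-sym 0 (suc (suc b)) = refl
bookSpine-sym 1 0 = refl
bookSpine-sym 1 1 = refl
bookSpine-sym 1 (suc (suc b)) = refl
bookSpine-sym (suc (suc a)) 0 = refl
bookSpine-sym (suc (suc a)) 1 = refl
bookSpine-sym (suc (suc a)) (suc (suc b)) = refl

bookSpine-irrefl : ∀ a → bookSpine a a ≡ false
bookSpine-irrefl 0 = refl
bookSpine-irrefl 1 = refl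
bookSpine-irrefl (suc (suc a)) = refl

Book : (p : ℕ) → SimpleGraph (suc (suc p))
Book p = record
  { Adj    = λ i j → bookSpine (toℕ i) (toℕ j)
  ; sym    = λ i j → bookSpine-sym (toℕ i) (toℕ j)
  ; irrefl = λ i → bookSpine-irrefl (toℕ i)
  }

IsEx : (n : ℕ) → {k : ℕ} → SimpleGraph k → ℕ → Set
IsEx n H m =
  (Σ (SimpleGraph n) λ G → (¬ (H ⊆G G)) × (edgeCount G ≡ m))
  × (∀ (G : SimpleGraph n) → ¬ (H ⊆G G) → edgeCount G ≤ m)

-- Write d̄(u) for the number of non-neighbours of u, u itself included. An edge uv of a graph on
-- n vertices has at least n − d̄(u) − d̄(v) common neighbours, and p common neighbours of an edge
-- span a copy of B_p. So in a B_p-free graph on n = p + 4 vertices every edge uv has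
-- d̄(u) + d̄(v) ≥ 5. This forces Σ d̄ ≥ 3n − 2: either some vertex is adjacent to all others, and
-- then every other vertex has d̄ ≥ 4, or every d̄ is at least 2 and the vertices with d̄ = 2 are
-- pairwise non-adjacent, so there are at most two of them. As 2e + Σ d̄ = n², the number e of edges
-- is at most (n² − 3n + 2)/2 = (p + 2)(p + 3)/2.
--
-- Equality holds for the complement of C_{p+2} ∪ K_2, whose non-degrees sum to 3n − 2. It is
-- B_p-free because the non-neighbours of the two ends of any of its edges include three vertices
-- outside the edge, which leaves room for at most p − 1 common neighbours.

module Submission where

open import Defs hiding (sym)
open SimpleGraph using () renaming (sym to Adj-sym)

open import Data.Nat.Properties hiding (_≟_)
open import Algebra.Properties.CommutativeMonoid.Sum +-0-commutativeMonoid
  using (sum-syntax; ∑-distrib-+; ∑-comm; sum-replicate-zero)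
open import Data.Bool using (Bool; true; false; _∧_; _∨_; not; if_then_else_; T)
open import Data.Bool.Properties using (not-involutive; ∨-comm; ∧-zeroʳ)
open import Data.Empty using (⊥-elim)
open import Data.Fin using (Fin; zero; suc; toℕ; fromℕ<)
open import Data.Fin.Properties using (_≟_; toℕ<n; toℕ-injective; toℕ-fromℕ<; injective⇒≤; any?)
import Data.Fin.Properties as Fin
open import Data.List using (map; tabulate; allFin)
open import Data.Nat using (ℕ; zero; suc; _+_; _*_; _/_; _≤_; _<_; _≡ᵇ_; _<ᵇ_; z≤n; s≤s; s≤s⁻¹)
import Data.Nat as ℕ
open import Data.Nat.DivMod using (m*n/n≡m; /-monoˡ-≤)
open import Data.Nat.ListAction using (sum)
open import Data.Nat.Tactic.RingSolver using (solve-∀)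
open import Data.Product using (Σ; _×_; _,_; proj₁; proj₂)
open import Data.Sum using (_⊎_; inj₁; inj₂) renaming (swap to ⊎-swap)
open import Data.Vec.Functional using (_∷_)
open import Function using (_∘_)
open import Function.Definitions using (Injective)
open import Relation.Binary using (tri<; tri≈; tri>)
open import Relation.Binary.PropositionalEquality
open import Relation.Nullary using (¬_; yes; no; does)

-- Finite sums and counting

χ : Bool → ℕ
χ b = if b then 1 else 0

∑-cong : ∀ {n} {f g : Fin n → ℕ} → (∀ i → f i ≡ g i) → ∑[ i < n ] f i ≡ ∑[ i < n ] g i
∑-cong {zero}  eq = refl
∑-cong {suc n} eq = cong₂ _+_ (eq zero) (∑-cong (eq ∘ suc))

∑-mono-≤ : ∀ {n} {f g : Fin n → ℕ} → (∀ i → f i ≤ g i) → ∑[ i < n ] f i ≤ ∑[ i < n ] g i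
∑-mono-≤ {zero}  le = z≤n
∑-mono-≤ {suc n} le = +-mono-≤ (le zero) (∑-mono-≤ (le ∘ suc))

∑-const : ∀ n c → ∑[ i < n ] c ≡ n * c
∑-const zero    c = refl
∑-const (suc n) c = cong (c +_) (∑-const n c)

∑-lower-bound : ∀ {n c k} (d e : Fin n → ℕ) → (∀ i → c ≤ d i + e i) → ∑[ i < n ] e i ≤ k →
                n * c ≤ ∑[ i < n ] d i + k
∑-lower-bound {n} {c} {k} d e c≤d+e ∑e≤k = begin
  n * c                             ≡⟨ ∑-const n c ⟨
  ∑[ i < n ] c                      ≤⟨ ∑-mono-≤ c≤d+e ⟩
  ∑[ i < n ] (d i + e i)            ≡⟨ ∑-distrib-+ d e ⟩
  ∑[ i < n ] d i + ∑[ i < n ] e i   ≤⟨ +-monoʳ-≤ (∑[ i < n ] d i) ∑e≤k ⟩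
  ∑[ i < n ] d i + k                ∎
  where open ≤-Reasoning

sum-map-tabulate : ∀ {A : Set} {n} (g : Fin n → A) (f : A → ℕ) →
                   sum (map f (tabulate g)) ≡ ∑[ i < n ] f (g i)
sum-map-tabulate {n = zero}  g f = refl
sum-map-tabulate {n = suc n} g f = cong (f (g zero) +_) (sum-map-tabulate (g ∘ suc) f)

≡ᵇ-true⇒≡ : ∀ {m n} → (m ≡ᵇ n) ≡ true → m ≡ n
≡ᵇ-true⇒≡ {m} {n} eq = ≡ᵇ⇒≡ m n (subst T (sym eq) _)

≡ᵇ-false⇒≢ : ∀ {m n} → (m ≡ᵇ n) ≡ false → m ≢ n
≡ᵇ-false⇒≢ {m} eq refl = subst T eq (≡⇒≡ᵇ m m refl)

≢⇒≡ᵇ-false : ∀ {m n} → m ≢ n → (m ≡ᵇ n) ≡ false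
≢⇒≡ᵇ-false {m} {n} m≢n with m ≡ᵇ n in eq
... | true  = ⊥-elim (m≢n (≡ᵇ-true⇒≡ eq))
... | false = refl

≡ᵇ-refl : ∀ m → (m ≡ᵇ m) ≡ true
≡ᵇ-refl zero    = refl
≡ᵇ-refl (suc m) = ≡ᵇ-refl m

≡ᵇ-sym : ∀ m n → (m ≡ᵇ n) ≡ (n ≡ᵇ m)
≡ᵇ-sym zero    zero    = refl
≡ᵇ-sym zero    (suc n) = refl
≡ᵇ-sym (suc m) zero    = refl
≡ᵇ-sym (suc m) (suc n) = ≡ᵇ-sym m n

<ᵇ-irrefl : ∀ m → (m <ᵇ m) ≡ false
<ᵇ-irrefl zero    = refl
<ᵇ-irrefl (suc m) = <ᵇ-irrefl m

<⇒<ᵇ-true : ∀ {m n} → m < n → (m <ᵇ n) ≡ true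
<⇒<ᵇ-true {m} {n} m<n with m <ᵇ n in eq
... | true  = refl
... | false = ⊥-elim (subst T eq (<⇒<ᵇ m<n))

not-∧ : ∀ x y → not (x ∧ y) ≡ not x ∨ not y
not-∧ true  _ = refl
not-∧ false _ = refl

not-¬∧¬ : ∀ x y → not (not x ∧ not y) ≡ x ∨ y
not-¬∧¬ true  _ = refl
not-¬∧¬ false y = not-involutive y

count : ∀ {n} → (Fin n → Bool) → ℕ
count {n} P = ∑[ i < n ] χ (P i)

χ-mono : ∀ {x y} → (x ≡ true → y ≡ true) → χ x ≤ χ y
χ-mono {false} _   = z≤n
χ-mono {true}  x⇒y rewrite x⇒y refl = ≤-refl

χ-∨ : ∀ x y → χ (x ∨ y) ≤ χ x + χ y
χ-∨ true  _ = s≤s z≤n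
χ-∨ false _ = ≤-refl

χ-not : ∀ x → χ x + χ (not x) ≡ 1
χ-not true  = refl
χ-not false = refl

count-mono : ∀ {n} {P Q : Fin n → Bool} → (∀ i → P i ≡ true → Q i ≡ true) → count P ≤ count Q
count-mono P⇒Q = ∑-mono-≤ (λ i → χ-mono (P⇒Q i))

count-∨ : ∀ {n} (P Q : Fin n → Bool) → count (λ i → P i ∨ Q i) ≤ count P + count Q
count-∨ P Q = ≤-trans (∑-mono-≤ (λ i → χ-∨ (P i) (Q i))) (≤-reflexive (∑-distrib-+ (χ ∘ P) (χ ∘ Q)))

count-∁ : ∀ {n} (P : Fin n → Bool) → count P + count (not ∘ P) ≡ n
count-∁ {n} P = begin
  count P + count (not ∘ P)    ≡⟨ ∑-distrib-+ (χ ∘ P) (χ ∘ not ∘ P) ⟨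
  ∑[ i < n ] (χ (P i) + χ (not (P i))) ≡⟨ ∑-cong (χ-not ∘ P) ⟩
  ∑[ i < n ] 1                 ≡⟨ ∑-const n 1 ⟩
  n * 1                        ≡⟨ *-identityʳ n ⟩
  n                            ∎
  where open ≡-Reasoning

count-disjoint : ∀ {n} (P Q : Fin n → Bool) → (∀ i → P i ≡ true → Q i ≡ false) → count P + count Q ≤ n
count-disjoint P Q disj = begin
  count P + count Q          ≤⟨ +-monoʳ-≤ (count P) (count-mono Q⇒¬P) ⟩
  count P + count (not ∘ P)  ≡⟨ count-∁ P ⟩
  _                          ∎
  where
  open ≤-Reasoning
  Q⇒¬P : ∀ i → Q i ≡ true → not (P i) ≡ true
  Q⇒¬P i Qi with P i in Pi
  ... | false = refl
  ... | true  with () ← trans (sym Qi) (disj i Pi)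

count≥1 : ∀ {n} (P : Fin n → Bool) {u} → P u ≡ true → 1 ≤ count P
count≥1 P {zero}  Pu rewrite Pu = s≤s z≤n
count≥1 P {suc u} Pu = ≤-trans (count≥1 (P ∘ suc) Pu) (m≤n+m _ (χ (P zero)))

count≥2 : ∀ {n} (P : Fin n → Bool) {u v} → u ≢ v → P u ≡ true → P v ≡ true → 2 ≤ count P
count≥2 P {zero}  {zero}  u≢v _  _  = ⊥-elim (u≢v refl)
count≥2 P {zero}  {suc v} _   Pu Pv rewrite Pu = s≤s (count≥1 (P ∘ suc) Pv)
count≥2 P {suc u} {zero}  _   Pu Pv rewrite Pv = s≤s (count≥1 (P ∘ suc) Pu)
count≥2 P {suc u} {suc v} u≢v Pu Pv =
  ≤-trans (count≥2 (P ∘ suc) (u≢v ∘ cong suc) Pu Pv) (m≤n+m _ (χ (P zero)))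

count-≟ : ∀ {n} (u : Fin n) → count (λ v → does (v ≟ u)) ≡ 1
count-≟ {suc n} zero    = cong suc (sum-replicate-zero n)
count-≟         (suc u) = count-≟ u

count-label : ∀ n k → count {n} (λ j → toℕ j ≡ᵇ k) ≡ χ (k <ᵇ n)
count-label zero    zero    = refl
count-label zero    (suc k) = refl
count-label (suc n) zero    = cong suc (sum-replicate-zero n)
count-label (suc n) (suc k) = count-label n k

count-label< : ∀ {n k} → k < n → count {n} (λ j → toℕ j ≡ᵇ k) ≡ 1
count-label< {n} {k} k<n = trans (count-label n k) (cong χ (<⇒<ᵇ-true k<n))

-- Degrees, non-degrees and common neighbours

adjacent⇒≢ : ∀ {n} (G : SimpleGraph n) {u v} → Adj G u v ≡ true → u ≢ v
adjacent⇒≢ G {u} uv refl with () ← trans (sym uv) (irrefl G u)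

module _ {n : ℕ} (G : SimpleGraph n) where

  degree nonDegree : Fin n → ℕ
  degree    u = count (Adj G u)
  nonDegree u = count (λ v → not (Adj G u v))

  commonNeighbour : Fin n → Fin n → Fin n → Bool
  commonNeighbour u v w = Adj G u w ∧ Adj G v w

  codegree : Fin n → Fin n → ℕ
  codegree u v = count (commonNeighbour u v)

χ-split : ∀ a b x → (a ≡ b → x ≡ false) → χ x ≡ χ ((a <ᵇ b) ∧ x) + χ ((b <ᵇ a) ∧ x)
χ-split zero    zero    x loop rewrite loop refl = refl
χ-split zero    (suc b) x _    = sym (+-identityʳ (χ x))
χ-split (suc a) zero    x _    = refl
χ-split (suc a) (suc b) x loop = χ-split a b x (loop ∘ cong suc)

handshake : ∀ {n} (G : SimpleGraph n) → ∑[ u < n ] degree G u ≡ edgeCount G * 2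
handshake {n} G = begin
  ∑[ u < n ] degree G u                                     ≡⟨ ∑-cong (λ u → trans (∑-cong (split u)) (∑-distrib-+ (arc u) (λ v → arc v u))) ⟩
  ∑[ u < n ] (∑[ v < n ] arc u v + ∑[ v < n ] arc v u)      ≡⟨ ∑-distrib-+ (λ u → ∑[ v < n ] arc u v) (λ u → ∑[ v < n ] arc v u) ⟩
  E + ∑[ u < n ] ∑[ v < n ] arc v u                         ≡⟨ cong (E +_) (∑-comm (λ u v → arc v u)) ⟩
  E + E                                                     ≡⟨ cong (E +_) (+-identityʳ E) ⟨
  2 * E                                                     ≡⟨ *-comm 2 E ⟩
  E * 2                                                     ≡⟨ cong (_* 2) edgeCount≡E ⟨
  edgeCount G * 2                                           ∎
  where
  open ≡-Reasoning
  arc : Fin n → Fin n → ℕ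
  arc u v = χ ((toℕ u <ᵇ toℕ v) ∧ Adj G u v)
  E : ℕ
  E = ∑[ u < n ] ∑[ v < n ] arc u v
  edgeCount≡E : edgeCount G ≡ E
  edgeCount≡E = trans (sum-map-tabulate (λ u → u) (λ u → sum (map (arc u) (allFin n))))
                      (∑-cong (λ u → sum-map-tabulate (λ v → v) (arc u)))
  split : ∀ u v → χ (Adj G u v) ≡ arc u v + arc v u
  split u v rewrite Adj-sym G v u =
    χ-split (toℕ u) (toℕ v) (Adj G u v) (λ eq → subst (λ w → Adj G u w ≡ false) (toℕ-injective eq) (irrefl G u))

edgeCount*2+∑nonDegree : ∀ {n} (G : SimpleGraph n) → edgeCount G * 2 + ∑[ u < n ] nonDegree G u ≡ n * n
edgeCount*2+∑nonDegree {n} G = begin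
  edgeCount G * 2 + ∑[ u < n ] nonDegree G u             ≡⟨ cong (_+ ∑[ u < n ] nonDegree G u) (handshake G) ⟨
  ∑[ u < n ] degree G u + ∑[ u < n ] nonDegree G u       ≡⟨ ∑-distrib-+ (degree G) (nonDegree G) ⟨
  ∑[ u < n ] (degree G u + nonDegree G u)                ≡⟨ ∑-cong (λ u → count-∁ (Adj G u)) ⟩
  ∑[ u < n ] n                                           ≡⟨ ∑-const n n ⟩
  n * n                                                  ∎
  where open ≡-Reasoning

n≤codegree+nonDegrees : ∀ {n} (G : SimpleGraph n) u v →
                        n ≤ codegree G u v + (nonDegree G u + nonDegree G v)
n≤codegree+nonDegrees {n} G u v = begin
  n                                                         ≡⟨ count-∁ (commonNeighbour G u v) ⟨
  codegree G u v + count (not ∘ commonNeighbour G u v)      ≡⟨ cong (codegree G u v +_) (∑-cong (λ w → cong χ (not-∧ (Adj G u w) (Adj G v w)))) ⟩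
  codegree G u v + count (λ w → not (Adj G u w) ∨ not (Adj G v w))
                                                            ≤⟨ +-monoʳ-≤ (codegree G u v) (count-∨ (λ w → not (Adj G u w)) (λ w → not (Adj G v w))) ⟩
  codegree G u v + (nonDegree G u + nonDegree G v)          ∎
  where open ≤-Reasoning

nonDegree≥1 : ∀ {n} (G : SimpleGraph n) u → 1 ≤ nonDegree G u
nonDegree≥1 G u = count≥1 (λ v → not (Adj G u v)) (cong not (irrefl G u))

nonDegree≡1⇒adjacent : ∀ {n} (G : SimpleGraph n) {u v} → nonDegree G u ≡ 1 → u ≢ v → Adj G u v ≡ true
nonDegree≡1⇒adjacent G {u} {v} nd≡1 u≢v with Adj G u v in uv
... | true  = refl
... | false = ⊥-elim (<-irrefl refl (subst (2 ≤_) nd≡1 two≤nd))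
  where
  two≤nd : 2 ≤ nonDegree G u
  two≤nd = count≥2 (λ w → not (Adj G u w)) u≢v (cong not (irrefl G u)) (cong not uv)

module _ {n : ℕ} (G : SimpleGraph n)
         (heavy : ∀ {u v} → Adj G u v ≡ true → 5 ≤ nonDegree G u + nonDegree G v) where

  private
    nd = nonDegree G

  -- Two vertices of non-degree 2 cannot be adjacent, so all of them are non-neighbours of any one of them.
  count-nonDegree≡2 : count (λ v → nd v ≡ᵇ 2) ≤ 2
  count-nonDegree≡2 with any? (λ x → nd x ℕ.≟ 2)
  ... | yes (x , x≡2) = subst (count (λ v → nd v ≡ᵇ 2) ≤_) x≡2 (count-mono non-neighbour)
    where
    non-neighbour : ∀ t → (nd t ≡ᵇ 2) ≡ true → not (Adj G x t) ≡ true
    non-neighbour t t≡2 with Adj G x t in xt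
    ... | true  = ⊥-elim (<-irrefl refl (subst (5 ≤_) (cong₂ _+_ x≡2 (≡ᵇ-true⇒≡ t≡2)) (heavy xt)))
    ... | false = refl
  ... | no none = ≤-trans (≤-reflexive (trans (∑-cong zero-term) (sum-replicate-zero n))) z≤n
    where
    zero-term : ∀ t → χ (nd t ≡ᵇ 2) ≡ 0
    zero-term t with nd t ≡ᵇ 2 in t≡2
    ... | true  = ⊥-elim (none (t , ≡ᵇ-true⇒≡ t≡2))
    ... | false = refl

  ∑nonDegree≥ : n * 3 ≤ ∑[ v < n ] nd v + 2
  ∑nonDegree≥ with any? (λ u → nd u ℕ.≟ 1)
  ... | yes (u , u≡1) =
    ∑-lower-bound nd (λ v → at-u v + at-u v) pointwise
                  (≤-reflexive (trans (∑-distrib-+ at-u at-u) (cong₂ _+_ (count-≟ u) (count-≟ u))))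
    where
    at-u : Fin n → ℕ
    at-u v = χ (does (v ≟ u))
    pointwise : ∀ v → 3 ≤ nd v + (at-u v + at-u v)
    pointwise v with v ≟ u
    ... | yes refl = +-monoˡ-≤ 2 (nonDegree≥1 G v)
    ... | no v≢u   = ≤-trans (n≤1+n 3) (≤-trans 4≤nd (m≤m+n (nd v) 0))
      where
      4≤nd : 4 ≤ nd v
      4≤nd = +-cancelˡ-≤ 1 4 (nd v) (subst (λ d → 5 ≤ d + nd v) u≡1 (heavy (nonDegree≡1⇒adjacent G u≡1 (v≢u ∘ sym))))
  ... | no none = ∑-lower-bound nd (λ v → χ (nd v ≡ᵇ 2)) pointwise count-nonDegree≡2
    where
    pointwise : ∀ v → 3 ≤ nd v + χ (nd v ≡ᵇ 2)
    pointwise v with nd v ≡ᵇ 2 in v≡2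
    ... | true  = subst (λ d → 3 ≤ d + 1) (sym (≡ᵇ-true⇒≡ v≡2)) ≤-refl
    ... | false = ≤-trans (≤∧≢⇒< (≤∧≢⇒< (nonDegree≥1 G v) (λ eq → none (v , sym eq))) (≡ᵇ-false⇒≢ v≡2 ∘ sym))
                            (m≤m+n (nd v) 0)

-- Books

∷-injective : ∀ {k n} {h : Fin k → Fin n} {w} →
              Injective _≡_ _≡_ h → (∀ i → h i ≢ w) → Injective _≡_ _≡_ (w ∷ h)
∷-injective inj fresh {zero}  {zero}  _  = refl
∷-injective inj fresh {zero}  {suc j} eq = ⊥-elim (fresh j (sym eq))
∷-injective inj fresh {suc i} {zero}  eq = ⊥-elim (fresh i eq)
∷-injective inj fresh {suc i} {suc j} eq = cong suc (inj eq)

select : ∀ {n} k (P : Fin n → Bool) → k ≤ count P →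
         Σ (Fin k → Fin n) λ g → Injective _≡_ _≡_ g × (∀ i → P (g i) ≡ true)
select {n}     zero    P _ = (λ ()) , (λ {i} → ⊥-elim (Fin.¬Fin0 i)) , (λ ())
select {suc n} (suc k) P k<count with P zero in P0
... | false with select (suc k) (P ∘ suc) k<count
...   | g , g-inj , Pg = suc ∘ g , g-inj ∘ Fin.suc-injective , Pg
select {suc n} (suc k) P (s≤s k≤count) | true with select k (P ∘ suc) k≤count
...   | g , g-inj , Pg = zero ∷ suc ∘ g , ∷-injective (g-inj ∘ Fin.suc-injective) (λ i ()) , P∷
  where
  P∷ : ∀ i → P ((zero ∷ suc ∘ g) i) ≡ true
  P∷ zero    = P0
  P∷ (suc i) = Pg i

∧-true : ∀ {x y} → (x ∧ y) ≡ true → x ≡ true × y ≡ true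
∧-true {true} {true} _ = refl , refl

book⊆G : ∀ {n p} (G : SimpleGraph n) {u v} → Adj G u v ≡ true → p ≤ codegree G u v → Book p ⊆G G
book⊆G {p = p} G {u} {v} uv p≤codeg with select p (commonNeighbour G u v) p≤codeg
... | g , g-inj , common = f , f-inj , f-edge
  where
  f : Fin (suc (suc p)) → _
  f = u ∷ v ∷ g
  u~g : ∀ i → Adj G u (g i) ≡ true
  u~g i = proj₁ (∧-true (common i))
  v~g : ∀ i → Adj G v (g i) ≡ true
  v~g i = proj₂ (∧-true (common i))
  g~u : ∀ i → Adj G (g i) u ≡ true
  g~u i = trans (Adj-sym G (g i) u) (u~g i)
  g~v : ∀ i → Adj G (g i) v ≡ true
  g~v i = trans (Adj-sym G (g i) v) (v~g i)
  f-inj : Injective _≡_ _≡_ f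
  f-inj = ∷-injective (∷-injective g-inj (λ i → adjacent⇒≢ G (g~v i)))
                      λ { zero → adjacent⇒≢ G (trans (Adj-sym G v u) uv) ; (suc i) → adjacent⇒≢ G (g~u i) }
  f-edge : ∀ i j → Adj (Book p) i j ≡ true → Adj G (f i) (f j) ≡ true
  f-edge zero                zero                ()
  f-edge zero                (suc zero)          _ = uv
  f-edge zero                (suc (suc j))       _ = u~g j
  f-edge (suc zero)          zero                _ = trans (Adj-sym G v u) uv
  f-edge (suc zero)          (suc zero)          ()
  f-edge (suc zero)          (suc (suc j))       _ = v~g j
  f-edge (suc (suc i))       zero                _ = g~u i
  f-edge (suc (suc i))       (suc zero)          _ = g~v i
  f-edge (suc (suc i))       (suc (suc j))       ()

bookFree⇒nonDegrees : ∀ {n p} (G : SimpleGraph n) → ¬ Book p ⊆G G →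
                      ∀ {u v} → Adj G u v ≡ true → n < p + (nonDegree G u + nonDegree G v)
bookFree⇒nonDegrees {n} {p} G B⊈G {u} {v} uv = begin-strict
  n                                                 ≤⟨ n≤codegree+nonDegrees G u v ⟩
  codegree G u v + (nonDegree G u + nonDegree G v)  <⟨ +-monoˡ-< _ (≰⇒> (B⊈G ∘ book⊆G G uv)) ⟩
  p + (nonDegree G u + nonDegree G v)               ∎
  where open ≤-Reasoning

Blocker : ∀ {n} → SimpleGraph n → Fin n → Fin n → Fin n → Set
Blocker G u v w = w ≢ u × w ≢ v × commonNeighbour G u v w ≡ false

record ThreeBlockers {n} (G : SimpleGraph n) (u v : Fin n) : Set where
  field
    w₁ w₂ w₃ : Fin n
    w₁≢w₂ : w₁ ≢ w₂
    w₁≢w₃ : w₁ ≢ w₃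
    w₂≢w₃ : w₂ ≢ w₃
    blocks₁ : Blocker G u v w₁
    blocks₂ : Blocker G u v w₂
    blocks₃ : Blocker G u v w₃

∉-∷ : ∀ {k n} {h : Fin k → Fin n} {w x} → x ≢ w → (∀ i → h i ≢ w) → ∀ i → (x ∷ h) i ≢ w
∉-∷ x≢w _ zero    = x≢w
∉-∷ _   h∌w (suc i) = h∌w i

book-avoids-blocker : ∀ {n p} (G : SimpleGraph n) ((h , _ , h-edge) : Book p ⊆G G) {w} →
                      Blocker G (h zero) (h (suc zero)) w → ∀ i → h i ≢ w
book-avoids-blocker G (h , _ , _)      (w≢u , _ , _) zero          = w≢u ∘ sym
book-avoids-blocker G (h , _ , _)      (_ , w≢v , _) (suc zero)    = w≢v ∘ sym
book-avoids-blocker G (h , _ , h-edge) (_ , _ , ¬common) (suc (suc k)) refl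
  rewrite h-edge zero (suc (suc k)) refl | h-edge (suc zero) (suc (suc k)) refl with () ← ¬common

¬Book⊆G : ∀ {n p} (G : SimpleGraph n) → n < p + 5 →
          (∀ {u v} → Adj G u v ≡ true → ThreeBlockers G u v) → ¬ Book p ⊆G G
¬Book⊆G {n} {p} G n<p+5 blockers B⊆G@(h , h-inj , h-edge) =
  <⇒≱ n<p+5 (subst (_≤ n) (+-comm 5 p) (injective⇒≤ extended-inj))
  where
  open ThreeBlockers (blockers (h-edge zero (suc zero) refl))
  avoids : ∀ {w} → Blocker G (h zero) (h (suc zero)) w → ∀ i → h i ≢ w
  avoids = book-avoids-blocker G B⊆G
  extended-inj : Injective _≡_ _≡_ (w₁ ∷ w₂ ∷ w₃ ∷ h)
  extended-inj =
    ∷-injective (∷-injective (∷-injective h-inj (avoids blocks₃))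
                             (∉-∷ (w₂≢w₃ ∘ sym) (avoids blocks₂)))
                (∉-∷ (w₁≢w₂ ∘ sym) (∉-∷ (w₁≢w₃ ∘ sym) (avoids blocks₁)))

-- The extremal graph

module Extremal (p : ℕ) where

  -- Its complement is the cycle 0, 1, …, p+1 plus the edge {p+2, p+3}: every complement edge joins
  -- a label a to next a, and next (p+3) = p+4 is not a vertex.
  next : ℕ → ℕ
  next a = if a ≡ᵇ suc p then 0 else suc a

  missing : ℕ → ℕ → Bool
  missing a b = (b ≡ᵇ next a) ∨ (a ≡ᵇ next b)

  adjacent : ℕ → ℕ → Bool
  adjacent a b = not (a ≡ᵇ b) ∧ not (missing a b)

  adjacent-sym : ∀ a b → adjacent a b ≡ adjacent b a
  adjacent-sym a b = cong₂ (λ x y → not x ∧ not y) (≡ᵇ-sym a b) (∨-comm (b ≡ᵇ next a) (a ≡ᵇ next b))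

  adjacent-irrefl : ∀ a → adjacent a a ≡ false
  adjacent-irrefl a rewrite ≡ᵇ-refl a = refl

  graph : SimpleGraph (p + 4)
  graph = record
    { Adj    = λ i j → adjacent (toℕ i) (toℕ j)
    ; sym    = λ i j → adjacent-sym (toℕ i) (toℕ j)
    ; irrefl = λ i → adjacent-irrefl (toℕ i)
    }

  next-≢ : ∀ {a} → a ≢ suc p → next a ≡ suc a
  next-≢ a≢ rewrite ≢⇒≡ᵇ-false a≢ = refl

  hasNext : Fin (p + 4) → Bool
  hasNext j = next (toℕ j) <ᵇ p + 4

  count-hasNext : count hasNext + 1 ≤ p + 4
  count-hasNext = subst (λ c → count hasNext + c ≤ p + 4) (count-label< last<n)
                        (count-disjoint hasNext (λ j → toℕ j ≡ᵇ 3 + p) not-last)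
    where
    last<n : 3 + p < p + 4
    last<n = subst (3 + p <_) (+-comm 4 p) ≤-refl
    last-has-no-next : (next (3 + p) <ᵇ p + 4) ≡ false
    last-has-no-next rewrite next-≢ {3 + p} (>⇒≢ (s≤s (n≤1+n (suc p)))) | +-comm p 4 = <ᵇ-irrefl (4 + p)
    not-last : ∀ j → hasNext j ≡ true → (toℕ j ≡ᵇ 3 + p) ≡ false
    not-last j has with toℕ j ≡ᵇ 3 + p in is-last
    ... | false = refl
    ... | true with () ← trans (sym has) (subst (λ a → (next a <ᵇ p + 4) ≡ false) (sym (≡ᵇ-true⇒≡ is-last)) last-has-no-next)

  isPrevious : Fin (p + 4) → Fin (p + 4) → Bool
  isPrevious i j = toℕ i ≡ᵇ next (toℕ j)

  nonDegree≤ : ∀ i → nonDegree graph i ≤ 1 + (χ (hasNext i) + count (isPrevious i))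
  nonDegree≤ i = begin
    nonDegree graph i
      ≡⟨ ∑-cong {p + 4} (λ j → cong χ (not-¬∧¬ (a ≡ᵇ toℕ j) (missing a (toℕ j)))) ⟩
    count (λ j → isSelf j ∨ (isNext j ∨ isPrevious i j))
      ≤⟨ count-∨ isSelf (λ j → isNext j ∨ isPrevious i j) ⟩
    count isSelf + count (λ j → isNext j ∨ isPrevious i j)
      ≤⟨ +-monoʳ-≤ (count isSelf) (count-∨ isNext (isPrevious i)) ⟩
    count isSelf + (count isNext + count (isPrevious i))
      ≡⟨ cong₂ (λ x y → x + (y + count (isPrevious i)))
               (trans (∑-cong {p + 4} (λ j → cong χ (≡ᵇ-sym a (toℕ j)))) (count-label< (toℕ<n i)))
               (count-label (p + 4) (next a)) ⟩
    1 + (χ (hasNext i) + count (isPrevious i))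
      ∎
    where
    open ≤-Reasoning
    a = toℕ i
    isSelf isNext : Fin (p + 4) → Bool
    isSelf j = a ≡ᵇ toℕ j
    isNext j = toℕ j ≡ᵇ next a

  ∑nonDegree≤ : ∑[ i < p + 4 ] nonDegree graph i + 2 ≤ (p + 4) * 3
  ∑nonDegree≤ = begin
    ∑[ i < n ] nonDegree graph i + 2
      ≤⟨ +-monoˡ-≤ 2 (∑-mono-≤ nonDegree≤) ⟩
    ∑[ i < n ] (1 + (χ (hasNext i) + P i)) + 2
      ≡⟨ cong (_+ 2) (trans (∑-distrib-+ (λ _ → 1) (λ i → χ (hasNext i) + P i))
                            (cong₂ _+_ (trans (∑-const n 1) (*-identityʳ n)) (∑-distrib-+ (χ ∘ hasNext) P))) ⟩
    n + (L + ∑[ i < n ] P i) + 2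
      ≡⟨ cong (λ x → n + (L + x) + 2) (trans (∑-comm (λ i j → χ (isPrevious i j))) (∑-cong {p + 4} (λ j → count-label n (next (toℕ j))))) ⟩
    n + (L + L) + 2
      ≡⟨ regroup n L ⟩
    n + ((L + 1) + (L + 1))
      ≤⟨ +-monoʳ-≤ n (+-mono-≤ count-hasNext count-hasNext) ⟩
    n + (n + n)
      ≡⟨ triple n ⟩
    n * 3
      ∎
    where
    open ≤-Reasoning
    n = p + 4
    L = count hasNext
    P : Fin n → ℕ
    P i = count (isPrevious i)
    regroup : ∀ n L → n + (L + L) + 2 ≡ n + ((L + 1) + (L + 1))
    regroup = solve-∀
    triple : ∀ n → n + (n + n) ≡ n * 3
    triple = solve-∀

  next-≢-self : ∀ a → next a ≢ a
  next-≢-self a with a ≡ᵇ suc p in is-last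
  ... | true  = λ 0≡a → 0≢1+n (trans 0≡a (≡ᵇ-true⇒≡ is-last))
  ... | false = 1+n≢n

  missing-irrefl : ∀ a → missing a a ≡ false
  missing-irrefl a rewrite ≢⇒≡ᵇ-false (next-≢-self a ∘ sym) = refl

  missing-sym : ∀ a b → missing a b ≡ missing b a
  missing-sym a b = ∨-comm (b ≡ᵇ next a) (a ≡ᵇ next b)

  missing-next : ∀ a → missing a (next a) ≡ true
  missing-next a rewrite ≡ᵇ-refl (next a) = refl

  missing-succ : ∀ {a} → a ≢ suc p → missing a (suc a) ≡ true
  missing-succ {a} a≢ = subst (λ b → missing a b ≡ true) (next-≢ a≢) (missing-next a)

  missing-pred : ∀ {a} → a ≢ suc p → missing (suc a) a ≡ true
  missing-pred {a} a≢ = trans (missing-sym (suc a) a) (missing-succ a≢)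

  missing-last-0 : missing (suc p) 0 ≡ true
  missing-last-0 rewrite ≡ᵇ-refl p = refl

  missing-0-last : missing 0 (suc p) ≡ true
  missing-0-last = trans (missing-sym 0 (suc p)) missing-last-0

  missing⇒¬adjacent : ∀ {a b} → missing a b ≡ true → adjacent a b ≡ false
  missing⇒¬adjacent {a} m rewrite m = ∧-zeroʳ (not (a ≡ᵇ _))

  adjacent⇒¬missing : ∀ {a b} → adjacent a b ≡ true → missing a b ≢ true
  adjacent⇒¬missing {a} {b} adj m with () ← trans (sym adj) (missing⇒¬adjacent {a} {b} m)

  Missing : ℕ → ℕ → ℕ → Set
  Missing a b x = missing a x ≡ true ⊎ missing b x ≡ true

  record LabelBlockers (a b : ℕ) : Set where
    constructor blockers
    field
      x y z : ℕ
      x<y   : x < y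
      y<z   : y < z
      z<n   : z < p + 4
      missing-x : Missing a b x
      missing-y : Missing a b y
      missing-z : Missing a b z

  swapBlockers : ∀ {a b} → LabelBlockers a b → LabelBlockers b a
  swapBlockers (blockers x y z x<y y<z z<n mx my mz) = blockers x y z x<y y<z z<n (⊎-swap mx) (⊎-swap my) (⊎-swap mz)

  ≤3+p⇒<n : ∀ {z} → z ≤ 3 + p → z < p + 4
  ≤3+p⇒<n {z} z≤ = subst (z <_) (+-comm 4 p) (s≤s z≤)

  <n⇒≤3+p : ∀ {z} → z < p + 4 → z ≤ 3 + p
  <n⇒≤3+p {z} z<n = s≤s⁻¹ (subst (z <_) (+-comm p 4) z<n)

  ≤p⇒≢1+p : ∀ {a} → a ≤ p → a ≢ suc p
  ≤p⇒≢1+p a≤p = <⇒≢ (s≤s a≤p)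

  module _ (3≤p : 3 ≤ p) where

    cycleBlockers : ∀ {a b z} → a ≤ suc p → suc p < z → z < p + 4 → Missing a b z → LabelBlockers a b
    cycleBlockers {zero} {z = z} _ p+1<z z<n mz =
      blockers 1 (suc p) z (s≤s (≤-trans (s≤s z≤n) 3≤p)) p+1<z z<n
               (inj₁ (missing-succ {0} (λ ()))) (inj₁ missing-0-last) mz
    cycleBlockers {suc a} {z = z} a<1+p p+1<z z<n mz with m≤n⇒m<n∨m≡n (s≤s⁻¹ a<1+p)
    ... | inj₁ a<p  = blockers a (suc (suc a)) z (n≤1+n (suc a)) (≤-<-trans (s≤s a<p) p+1<z) z<n
                               (inj₁ (missing-pred (≤p⇒≢1+p (<⇒≤ a<p)))) (inj₁ (missing-succ (≤p⇒≢1+p a<p))) mz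
    ... | inj₂ refl = blockers 0 a z (≤-trans (s≤s z≤n) 3≤p) (<-trans (n<1+n a) p+1<z) z<n
                               (inj₁ missing-last-0) (inj₁ (missing-pred (1+n≢n ∘ sym))) mz

    cycleCycleBlockers : ∀ {a b} → a < b → b ≤ suc p → adjacent a b ≡ true → LabelBlockers a b
    cycleCycleBlockers {zero} {suc zero} _ _ adj = ⊥-elim (adjacent⇒¬missing {0} {1} adj (missing-succ {0} (λ ())))
    cycleCycleBlockers {zero} {suc (suc c)} _ b≤1+p adj with m≤n⇒m<n∨m≡n b≤1+p
    ... | inj₂ b≡1+p = ⊥-elim (adjacent⇒¬missing {0} {suc (suc c)} adj (subst (λ b → missing 0 b ≡ true) (sym b≡1+p) missing-0-last))
    ... | inj₁ (s≤s b≤p) with m≤n⇒m<n∨m≡n b≤p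
    ...   | inj₁ b<p =
      blockers 1 (suc (suc (suc c))) (suc p) (s≤s (s≤s z≤n)) (s≤s b<p) (≤3+p⇒<n (m≤n+m (suc p) 2))
               (inj₁ (missing-succ {0} (λ ()))) (inj₂ (missing-succ (≤p⇒≢1+p b≤p))) (inj₁ missing-0-last)
    ...   | inj₂ b≡p =
      blockers 1 (suc c) (suc p) (s≤s 1≤c) (s≤s 1+c≤p) (≤3+p⇒<n (m≤n+m (suc p) 2))
               (inj₁ (missing-succ {0} (λ ()))) (inj₂ (missing-pred (≤p⇒≢1+p 1+c≤p))) (inj₁ missing-0-last)
      where
      1≤c : 1 ≤ c
      1≤c = s≤s⁻¹ (s≤s⁻¹ (subst (3 ≤_) (sym b≡p) 3≤p))
      1+c≤p : suc c ≤ p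
      1+c≤p = subst (suc c ≤_) b≡p (n≤1+n (suc c))
    cycleCycleBlockers {suc a} {b} a<b b≤1+p _ with m≤n⇒m<n∨m≡n b≤1+p
    ... | inj₁ (s≤s b≤p) =
      blockers a (suc (suc a)) (suc b) (n≤1+n (suc a)) (s≤s a<b) (≤3+p⇒<n (≤-trans (s≤s b≤p) (m≤n+m (suc p) 2)))
               (inj₁ (missing-pred (≤p⇒≢1+p a≤p))) (inj₁ (missing-succ (≤p⇒≢1+p 1+a≤p))) (inj₂ (missing-succ (≤p⇒≢1+p b≤p)))
      where
      1+a≤p : suc a ≤ p
      1+a≤p = ≤-trans (<⇒≤ a<b) b≤p
      a≤p : a ≤ p
      a≤p = ≤-trans (n≤1+n a) 1+a≤p
    cycleCycleBlockers {suc zero} {b} a<b b≤1+p _ | inj₂ refl =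
      blockers 0 2 p (s≤s z≤n) 3≤p (≤3+p⇒<n (m≤n+m p 3))
               (inj₁ (missing-pred {0} (λ ()))) (inj₁ (missing-succ (≤p⇒≢1+p (≤-trans (s≤s z≤n) 3≤p)))) (inj₂ (missing-pred (1+n≢n ∘ sym)))
    cycleCycleBlockers {suc (suc a)} {b} a<b b≤1+p _ | inj₂ refl =
      blockers 0 (suc a) (suc (suc (suc a))) (s≤s z≤n) (n≤1+n (suc (suc a))) (≤3+p⇒<n (≤-trans a<b (m≤n+m (suc p) 2)))
               (inj₂ missing-last-0) (inj₁ (missing-pred (≤p⇒≢1+p (≤-trans (n≤1+n (suc a)) 2+a≤p))))
               (inj₁ (missing-succ (≤p⇒≢1+p 2+a≤p)))
      where
      2+a≤p : suc (suc a) ≤ p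
      2+a≤p = s≤s⁻¹ a<b

    labelBlockers : ∀ {a b} → a < b → b < p + 4 → adjacent a b ≡ true → LabelBlockers a b
    labelBlockers {a} a<b b<n adj with m≤n⇒m<n∨m≡n (<n⇒≤3+p b<n)
    ... | inj₂ refl with m≤n⇒m<n∨m≡n (s≤s⁻¹ a<b)
    ...   | inj₂ refl = ⊥-elim (adjacent⇒¬missing {2 + p} {3 + p} adj (missing-succ 1+n≢n))
    ...   | inj₁ a<2+p =
      cycleBlockers (s≤s⁻¹ a<2+p) ≤-refl (≤3+p⇒<n (n≤1+n _)) (inj₂ (missing-pred 1+n≢n))
    labelBlockers {a} a<b b<n adj | inj₁ b<3+p with m≤n⇒m<n∨m≡n (s≤s⁻¹ b<3+p)
    ... | inj₂ refl = cycleBlockers (s≤s⁻¹ a<b) (s≤s (n≤1+n (suc p))) (≤3+p⇒<n ≤-refl) (inj₂ (missing-succ 1+n≢n))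
    ... | inj₁ b<2+p = cycleCycleBlockers a<b (s≤s⁻¹ b<2+p) adj

  missing-source : ∀ {a b} → adjacent a b ≡ true → ¬ Missing a b a
  missing-source {a}     _   (inj₁ maa) with () ← trans (sym maa) (missing-irrefl a)
  missing-source {a} {b} adj (inj₂ mba) = adjacent⇒¬missing {a} {b} adj (trans (missing-sym a b) mba)

  missing-target : ∀ {a b} → adjacent a b ≡ true → ¬ Missing a b b
  missing-target {a} {b} adj = missing-source {b} {a} (trans (adjacent-sym b a) adj) ∘ ⊎-swap

  blocker : ∀ {u v} → Adj graph u v ≡ true → ∀ {x} (x<n : x < p + 4) →
            Missing (toℕ u) (toℕ v) x → Blocker graph u v (fromℕ< x<n)
  blocker {u} {v} uv {x} x<n m = w≢u , w≢v , not-common m′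
    where
    w = fromℕ< x<n
    m′ : Missing (toℕ u) (toℕ v) (toℕ w)
    m′ = subst (Missing (toℕ u) (toℕ v)) (sym (toℕ-fromℕ< x<n)) m
    w≢u : w ≢ u
    w≢u w≡u = missing-source {toℕ u} {toℕ v} uv (subst (Missing (toℕ u) (toℕ v)) (cong toℕ w≡u) m′)
    w≢v : w ≢ v
    w≢v w≡v = missing-target {toℕ u} {toℕ v} uv (subst (Missing (toℕ u) (toℕ v)) (cong toℕ w≡v) m′)
    not-common : Missing (toℕ u) (toℕ v) (toℕ w) → commonNeighbour graph u v w ≡ false
    not-common (inj₁ mu) rewrite missing⇒¬adjacent {toℕ u} mu = refl
    not-common (inj₂ mv) rewrite missing⇒¬adjacent {toℕ v} mv = ∧-zeroʳ _

  fromLabelBlockers : ∀ {u v} → Adj graph u v ≡ true → LabelBlockers (toℕ u) (toℕ v) → ThreeBlockers graph u v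
  fromLabelBlockers uv (blockers x y z x<y y<z z<n mx my mz) = record
    { w₁ = fromℕ< x<n ; w₂ = fromℕ< y<n ; w₃ = fromℕ< z<n
    ; w₁≢w₂ = <⇒≢ x<y ∘ Fin.fromℕ<-injective x y x<n y<n
    ; w₁≢w₃ = <⇒≢ (<-trans x<y y<z) ∘ Fin.fromℕ<-injective x z x<n z<n
    ; w₂≢w₃ = <⇒≢ y<z ∘ Fin.fromℕ<-injective y z y<n z<n
    ; blocks₁ = blocker uv x<n mx ; blocks₂ = blocker uv y<n my ; blocks₃ = blocker uv z<n mz
    }
    where
    y<n = <-trans y<z z<n
    x<n = <-trans x<y y<n

  threeBlockers : 3 ≤ p → ∀ {u v} → Adj graph u v ≡ true → ThreeBlockers graph u v
  threeBlockers 3≤p {u} {v} uv with <-cmp (toℕ u) (toℕ v)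
  ... | tri< u<v _ _ = fromLabelBlockers uv (labelBlockers 3≤p u<v (toℕ<n v) uv)
  ... | tri≈ _ u≡v _ = ⊥-elim (adjacent⇒≢ graph uv (toℕ-injective u≡v))
  ... | tri> _ _ v<u = fromLabelBlockers uv (swapBlockers (labelBlockers 3≤p v<u (toℕ<n u) vu))
    where
    vu : adjacent (toℕ v) (toℕ u) ≡ true
    vu = trans (adjacent-sym (toℕ v) (toℕ u)) uv

  bookFree : 3 ≤ p → ¬ Book p ⊆G graph
  bookFree 3≤p = ¬Book⊆G graph (+-monoʳ-< p ≤-refl) (threeBlockers 3≤p)

module _ (p e s : ℕ) (double-count : e * 2 + s ≡ (p + 4) * (p + 4)) where

  private
    n = p + 4
    X = (p + 2) * (p + 3)

    n²+2≡X+3n : n * n + 2 ≡ X + n * 3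
    n²+2≡X+3n = identity p
      where
      identity : ∀ p → (p + 4) * (p + 4) + 2 ≡ (p + 2) * (p + 3) + (p + 4) * 3
      identity = solve-∀

  edgeCount≤ : n * 3 ≤ s + 2 → e ≤ X / 2
  edgeCount≤ 3n≤s+2 = subst (_≤ X / 2) (m*n/n≡m e 2) (/-monoˡ-≤ 2 (+-cancelʳ-≤ (n * 3) (e * 2) X (begin
    e * 2 + n * 3        ≤⟨ +-monoʳ-≤ (e * 2) 3n≤s+2 ⟩
    e * 2 + (s + 2)      ≡⟨ +-assoc (e * 2) s 2 ⟨
    e * 2 + s + 2        ≡⟨ cong (_+ 2) double-count ⟩
    n * n + 2            ≡⟨ n²+2≡X+3n ⟩
    X + n * 3            ∎)))
    where open ≤-Reasoning

  edgeCount≥ : s + 2 ≤ n * 3 → X / 2 ≤ e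
  edgeCount≥ s+2≤3n = subst (X / 2 ≤_) (m*n/n≡m e 2) (/-monoˡ-≤ 2 (+-cancelʳ-≤ (n * 3) X (e * 2) (begin
    X + n * 3            ≡⟨ n²+2≡X+3n ⟨
    n * n + 2            ≡⟨ cong (_+ 2) double-count ⟨
    e * 2 + s + 2        ≡⟨ +-assoc (e * 2) s 2 ⟩
    e * 2 + (s + 2)      ≤⟨ +-monoʳ-≤ (e * 2) s+2≤3n ⟩
    e * 2 + n * 3        ∎)))
    where open ≤-Reasoning

theorem6 : ∀ (p : ℕ) → 3 ≤ p → IsEx (p + 4) (Book p) (((p + 2) * (p + 3)) / 2)
theorem6 p 3≤p = (graph , bookFree 3≤p , ≤-antisym (upper graph (bookFree 3≤p)) lower) , upper
  where
  open Extremal p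
  upper : ∀ G → ¬ Book p ⊆G G → edgeCount G ≤ (p + 2) * (p + 3) / 2
  upper G B⊈G = edgeCount≤ p _ _ (edgeCount*2+∑nonDegree G) (∑nonDegree≥ G heavy)
    where
    heavy : ∀ {u v} → Adj G u v ≡ true → 5 ≤ nonDegree G u + nonDegree G v
    heavy uv = +-cancelˡ-< p 4 _ (bookFree⇒nonDegrees G B⊈G uv)
  lower : (p + 2) * (p + 3) / 2 ≤ edgeCount graph
  lower = edgeCount≥ p _ _ (edgeCount*2+∑nonDegree graph) ∑nonDegree≤
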